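{- Let $e_1,\dots,e_k\in\mathbb{N}$ with $1\le e_1\le e_2\le\dots\le e_k$, let $1\le t\le n$, and let $e=\sum_{i=1}^k e_i$. Then the number of $k$-tuples $(a_1,\dots,a_k)$ with $a_i\in[n]$ for all $i\in[k]$, $a_i\ge t$ for all $i\in[k]$ with $e_i\ge 2$, and $\prod_{i=1}^k a_i^{e_i}\le n$, is at most $n\,t^{k-e}D(n)^k$.
   Context: $D(n)=\max_{1\le i\le n} d(i)$, where $d(i)$ is the number of positive divisors of $i$. -}

module Defs where

open import Data.Nat using (ℕ; zero; suc; _*_; _^_; _≤_; _≤?_; _⊔_)
open import Data.Nat.Divisibility using (_∣?_)
open import Data.List using (List; []; _∷_; length; filter; applyUpTo; map; foldr; concatMap)
open import Data.Vec using (Vec; lookup) renaming ([] to []ᵥ; _∷_ to _∷ᵥ_)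
open import Data.Fin using (Fin)
open import Data.Fin.Properties using (all?)
open import Data.Product using (_×_)
open import Relation.Nullary using (Dec)
open import Relation.Nullary.Decidable using (_×-dec_; _→-dec_)

d : ℕ → ℕ
d i = length (filter (λ j → j ∣? i) (applyUpTo suc i))

-- D n = max_{1 ≤ i ≤ n} d i   (D 0 = 0, empty max)
D : ℕ → ℕ
D n = foldr _⊔_ 0 (map d (applyUpTo suc n))

tuples : ℕ → (k : ℕ) → List (Vec ℕ k)
tuples n zero = []ᵥ ∷ []
tuples n (suc k) = concatMap (λ a → map (a ∷ᵥ_) (tuples n k)) (applyUpTo suc n)

prodPow : ∀ {k} → Vec ℕ k → Vec ℕ k → ℕ
prodPow []ᵥ []ᵥ = 1
prodPow (a ∷ᵥ as) (x ∷ᵥ xs) = a ^ x * prodPow as xs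

Good : ∀ {k} → ℕ → ℕ → Vec ℕ k → Vec ℕ k → Set
Good {k} n t e a =
  ((i : Fin k) → 2 ≤ lookup e i → t ≤ lookup a i) × (prodPow a e ≤ n)

good? : ∀ {k} n t (e a : Vec ℕ k) → Dec (Good n t e a)
good? n t e a =
  all? (λ i → (2 ≤? lookup e i) →-dec (t ≤? lookup a i)) ×-dec (prodPow a e ≤? n)

count : ∀ {k} → ℕ → ℕ → Vec ℕ k → ℕ
count {k} n t e = length (filter (good? n t e) (tuples n k))

-- Since every e_i ≥ 1 and a_i ≥ t whenever e_i ≥ 2, a good tuple satisfies
-- a_1⋯a_k · t^(e−k) ≤ ∏ a_i^(e_i) ≤ n.  Hence it suffices to count tuples whose product
-- m satisfies m · t^(e−k) ≤ n.  There are at most n / t^(e−k) such values of m, and each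
-- is the product of at most D(n)^k tuples: choosing the entries one by one, every entry
-- must divide m, so there are at most d(m) ≤ D(n) choices for each.
module Submission where

open import Defs
open import Level using (Level)
open import Data.Nat
  using (ℕ; zero; suc; _+_; _*_; _^_; _∸_; _≤_; _<_; _⊔_; z≤n; s≤s; _≤?_; _≟_; _≤′_; ≤′-refl; ≤′-step; >-nonZero)
open import Data.Nat.Properties
open import Data.Nat.Divisibility using (_∣_; _∣?_; divides; ∣⇒≤)
open import Data.Nat.Solver using (module +-*-Solver)
open import Algebra.Properties.CommutativeSemigroup *-commutativeSemigroup using (xy∙z≈xz∙y)
open import Data.Vec using (Vec; lookup; sum) renaming ([] to []ᵥ; _∷_ to _∷ᵥ_)
open import Data.Fin using (Fin) renaming (_≤_ to _≤ᶠ_; zero to fz; suc to fs)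
open import Data.List using (List; []; _∷_; _++_; [_]; map; concatMap; applyUpTo; filter; length; foldr)
open import Data.List.Properties using (applyUpTo-∷ʳ; length-applyUpTo)
open import Data.List.Membership.Propositional using (_∈_)
open import Data.List.Membership.Propositional.Properties using (∈-applyUpTo⁺; ∈-applyUpTo⁻)
open import Data.List.Relation.Unary.All as All using (All; []; _∷_)
import Data.List.Relation.Unary.All.Properties as Allₚ
open import Data.List.Relation.Unary.Any using (here; there)
open import Data.Product using (_×_; _,_; proj₁)
open import Relation.Nullary using (Dec; yes; no; contradiction)
open import Relation.Unary using (Pred; Decidable)
open import Relation.Binary.PropositionalEquality
  using (_≡_; refl; sym; trans; cong; cong₂; subst; module ≡-Reasoning)

private variable
  ℓ : Level
  A B P Q R : Set ℓ

𝟙 : Dec P → ℕ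
𝟙 (yes _) = 1
𝟙 (no _)  = 0

𝟙-yes : P → (p? : Dec P) → 𝟙 p? ≡ 1
𝟙-yes p (yes _) = refl
𝟙-yes p (no ¬p) = contradiction p ¬p

𝟙≤1 : (p? : Dec P) → 𝟙 p? ≤ 1
𝟙≤1 (yes _) = ≤-refl
𝟙≤1 (no _)  = z≤n

𝟙-mono : (P → Q) → (p? : Dec P) (q? : Dec Q) → 𝟙 p? ≤ 𝟙 q?
𝟙-mono f (yes p) (yes _) = ≤-refl
𝟙-mono f (yes p) (no ¬q) = contradiction (f p) ¬q
𝟙-mono f (no _)  _       = z≤n

𝟙-mono-× : (P → Q × R) → (p? : Dec P) (q? : Dec Q) (r? : Dec R) → 𝟙 p? ≤ 𝟙 q? * 𝟙 r?
𝟙-mono-× f (yes p) q? r? with f p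
... | q , r rewrite 𝟙-yes q q? | 𝟙-yes r r? = ≤-refl
𝟙-mono-× f (no _)  q? r? = z≤n

∑ : List A → (A → ℕ) → ℕ
∑ []       f = 0
∑ (x ∷ xs) f = f x + ∑ xs f

infix 5 ∑
syntax ∑ xs (λ x → f) = ∑[ x ∈ xs ] f

module _ {f g : A → ℕ} where

  ∑-cong : (xs : List A) → (∀ x → f x ≡ g x) → ∑ xs f ≡ ∑ xs g
  ∑-cong []       f≗g = refl
  ∑-cong (x ∷ xs) f≗g = cong₂ _+_ (f≗g x) (∑-cong xs f≗g)

  ∑-mono : {xs : List A} → All (λ x → f x ≤ g x) xs → ∑ xs f ≤ ∑ xs g
  ∑-mono []             = ≤-refl
  ∑-mono (fx≤gx ∷ ps) = +-mono-≤ fx≤gx (∑-mono ps)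

  ∑-+ : (xs : List A) → ∑[ x ∈ xs ] (f x + g x) ≡ ∑ xs f + ∑ xs g
  ∑-+ []       = refl
  ∑-+ (x ∷ xs) rewrite ∑-+ xs = solve 4 (λ a b c d → (a :+ b) :+ (c :+ d) := (a :+ c) :+ (b :+ d))
                                  refl (f x) (g x) (∑ xs f) (∑ xs g)
    where open +-*-Solver

module _ (f : A → ℕ) where

  ∑-++ : (xs ys : List A) → ∑ (xs ++ ys) f ≡ ∑ xs f + ∑ ys f
  ∑-++ []       ys = refl
  ∑-++ (x ∷ xs) ys = trans (cong (f x +_) (∑-++ xs ys)) (sym (+-assoc (f x) _ _))

  ∑-concatMap : (g : B → List A) (ys : List B) → ∑ (concatMap g ys) f ≡ ∑[ y ∈ ys ] ∑ (g y) f
  ∑-concatMap g []       = refl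
  ∑-concatMap g (y ∷ ys) = trans (∑-++ (g y) (concatMap g ys)) (cong (∑ (g y) f +_) (∑-concatMap g ys))

  ∑-map : (g : B → A) (ys : List B) → ∑ (map g ys) f ≡ ∑[ y ∈ ys ] f (g y)
  ∑-map g []       = refl
  ∑-map g (y ∷ ys) = cong (f (g y) +_) (∑-map g ys)

  ∑-*ˡ : (c : ℕ) (xs : List A) → ∑[ x ∈ xs ] (c * f x) ≡ c * ∑ xs f
  ∑-*ˡ c []       = sym (*-zeroʳ c)
  ∑-*ˡ c (x ∷ xs) = trans (cong (c * f x +_) (∑-*ˡ c xs)) (sym (*-distribˡ-+ c (f x) (∑ xs f)))

  ∑-*ʳ : (c : ℕ) (xs : List A) → ∑[ x ∈ xs ] (f x * c) ≡ ∑ xs f * c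
  ∑-*ʳ c []       = refl
  ∑-*ʳ c (x ∷ xs) = trans (cong (f x * c +_) (∑-*ʳ c xs)) (sym (*-distribʳ-+ c (f x) (∑ xs f)))

  ∈⇒≤∑ : {y : A} {xs : List A} → y ∈ xs → f y ≤ ∑ xs f
  ∈⇒≤∑ {xs = x ∷ xs} (here refl) = m≤m+n (f x) _
  ∈⇒≤∑ {xs = x ∷ xs} (there y∈xs) = ≤-trans (∈⇒≤∑ y∈xs) (m≤n+m _ (f x))

∑-zero : (xs : List A) → ∑[ x ∈ xs ] 0 ≡ 0
∑-zero []       = refl
∑-zero (x ∷ xs) = ∑-zero xs

∑-comm : (f : A → B → ℕ) (xs : List A) (ys : List B) →
         ∑[ x ∈ xs ] ∑[ y ∈ ys ] f x y ≡ ∑[ y ∈ ys ] ∑[ x ∈ xs ] f x y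
∑-comm f []       ys = sym (∑-zero ys)
∑-comm f (x ∷ xs) ys = trans (cong (∑ ys (f x) +_) (∑-comm f xs ys)) (sym (∑-+ ys))

module _ {P : Pred A ℓ} (P? : Decidable P) where

  length-filter≡∑𝟙 : (xs : List A) → length (filter P? xs) ≡ ∑[ x ∈ xs ] 𝟙 (P? x)
  length-filter≡∑𝟙 []       = refl
  length-filter≡∑𝟙 (x ∷ xs) with P? x
  ... | yes _ = cong suc (length-filter≡∑𝟙 xs)
  ... | no _  = length-filter≡∑𝟙 xs

  ∑𝟙≤length : (xs : List A) → ∑[ x ∈ xs ] 𝟙 (P? x) ≤ length xs
  ∑𝟙≤length []       = z≤n
  ∑𝟙≤length (x ∷ xs) = +-mono-≤ (𝟙≤1 (P? x)) (∑𝟙≤length xs)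

∑𝟙≤∑fibres : (f : A → ℕ) {Q : Pred ℕ ℓ} (Q? : Decidable Q) (xs : List A) (U : List ℕ) →
             All (λ x → Q (f x) → f x ∈ U) xs →
             ∑[ x ∈ xs ] 𝟙 (Q? (f x)) ≤ ∑[ m ∈ U ] 𝟙 (Q? m) * (∑[ x ∈ xs ] 𝟙 (f x ≟ m))
∑𝟙≤∑fibres f {Q} Q? xs U f∈U = begin
  ∑[ x ∈ xs ] 𝟙 (Q? (f x))                          ≤⟨ ∑-mono (All.map inFibre f∈U) ⟩
  ∑[ x ∈ xs ] ∑[ m ∈ U ] 𝟙 (Q? m) * 𝟙 (f x ≟ m)     ≡⟨ ∑-comm (λ x m → 𝟙 (Q? m) * 𝟙 (f x ≟ m)) xs U ⟩
  ∑[ m ∈ U ] ∑[ x ∈ xs ] 𝟙 (Q? m) * 𝟙 (f x ≟ m)     ≡⟨ ∑-cong U (λ m → ∑-*ˡ (λ x → 𝟙 (f x ≟ m)) (𝟙 (Q? m)) xs) ⟩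
  ∑[ m ∈ U ] 𝟙 (Q? m) * (∑[ x ∈ xs ] 𝟙 (f x ≟ m))     ∎
  where
  open ≤-Reasoning
  inFibre : ∀ {x} → (Q (f x) → f x ∈ U) → 𝟙 (Q? (f x)) ≤ ∑[ m ∈ U ] 𝟙 (Q? m) * 𝟙 (f x ≟ m)
  inFibre {x} fx∈U with Q? (f x) in eq
  ... | no _  = z≤n
  ... | yes q = ≤-trans (≤-reflexive (sym 𝟙[fx]≡1)) (∈⇒≤∑ (λ m → 𝟙 (Q? m) * 𝟙 (f x ≟ m)) (fx∈U q))
    where
    𝟙[fx]≡1 : 𝟙 (Q? (f x)) * 𝟙 (f x ≟ f x) ≡ 1
    𝟙[fx]≡1 rewrite eq | 𝟙-yes refl (f x ≟ f x) = refl

range : ℕ → List ℕ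
range n = applyUpTo suc n

∈-range⁺ : ∀ {m n} → 1 ≤ m → m ≤ n → m ∈ range n
∈-range⁺ {suc m} (s≤s _) m<n = ∈-applyUpTo⁺ suc m<n

∈-range⁻ : ∀ {m n} → m ∈ range n → 1 ≤ m × m ≤ n
∈-range⁻ m∈ with ∈-applyUpTo⁻ suc m∈
... | i , i<n , refl = s≤s z≤n , i<n

∑-range-suc : (f : ℕ → ℕ) (n : ℕ) → ∑ (range (suc n)) f ≡ ∑ (range n) f + f (suc n)
∑-range-suc f n = begin
  ∑ (range (suc n)) f            ≡⟨ cong (λ xs → ∑ xs f) (sym (applyUpTo-∷ʳ suc n)) ⟩
  ∑ (range n ++ [ suc n ]) f     ≡⟨ ∑-++ f (range n) [ suc n ] ⟩
  ∑ (range n) f + (f (suc n) + 0) ≡⟨ cong (∑ (range n) f +_) (+-identityʳ (f (suc n))) ⟩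
  ∑ (range n) f + f (suc n)      ∎
  where open ≡-Reasoning

∑-range-vanishing : (f : ℕ → ℕ) {m n : ℕ} → (∀ a → m < a → f a ≡ 0) → m ≤′ n →
                    ∑ (range n) f ≡ ∑ (range m) f
∑-range-vanishing f vanish ≤′-refl = refl
∑-range-vanishing f {m} vanish (≤′-step {n} m≤′n) = begin
  ∑ (range (suc n)) f            ≡⟨ ∑-range-suc f n ⟩
  ∑ (range n) f + f (suc n)      ≡⟨ cong (∑ (range n) f +_) (vanish (suc n) (s≤s (≤′⇒≤ m≤′n))) ⟩
  ∑ (range n) f + 0              ≡⟨ +-identityʳ _ ⟩
  ∑ (range n) f                  ≡⟨ ∑-range-vanishing f vanish m≤′n ⟩
  ∑ (range m) f                  ∎
  where open ≡-Reasoning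

∑[m≤j]𝟙[m*s≤n]*s≤n : ∀ s n j → (∑[ m ∈ range j ] 𝟙 (m * s ≤? n)) * s ≤ n
∑[m≤j]𝟙[m*s≤n]*s≤n s n zero    = z≤n
∑[m≤j]𝟙[m*s≤n]*s≤n s n (suc j) rewrite ∑-range-suc (λ m → 𝟙 (m * s ≤? n)) j
  with ∑[ m ∈ range j ] 𝟙 (m * s ≤? n) | ∑𝟙≤length (λ m → m * s ≤? n) (range j)
     | ∑[m≤j]𝟙[m*s≤n]*s≤n s n j | suc j * s ≤? n
... | c | c≤j | _ | yes [1+j]*s≤n = begin
  (c + 1) * s  ≡⟨ cong (_* s) (+-comm c 1) ⟩
  suc c * s    ≤⟨ *-monoˡ-≤ s (s≤s (subst (c ≤_) (length-applyUpTo suc j) c≤j)) ⟩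
  suc j * s    ≤⟨ [1+j]*s≤n ⟩
  n            ∎
  where open ≤-Reasoning
... | c | _ | c*s≤n | no _ = subst (λ c′ → c′ * s ≤ n) (sym (+-identityʳ c)) c*s≤n

∑[a≤n]𝟙[a∣m]≡d : ∀ {m n} → 1 ≤ m → m ≤ n → ∑[ a ∈ range n ] 𝟙 (a ∣? m) ≡ d m
∑[a≤n]𝟙[a∣m]≡d {m} {n} 1≤m m≤n = begin
  ∑[ a ∈ range n ] 𝟙 (a ∣? m) ≡⟨ ∑-range-vanishing (λ a → 𝟙 (a ∣? m)) noLargeDivisor (≤⇒≤′ m≤n) ⟩
  ∑[ a ∈ range m ] 𝟙 (a ∣? m) ≡⟨ sym (length-filter≡∑𝟙 (_∣? m) (range m)) ⟩
  d m                         ∎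
  where
  open ≡-Reasoning
  noLargeDivisor : ∀ a → m < a → 𝟙 (a ∣? m) ≡ 0
  noLargeDivisor a m<a with a ∣? m
  ... | yes a∣m = contradiction (∣⇒≤ {{>-nonZero 1≤m}} a∣m) (<⇒≱ m<a)
  ... | no _    = refl

d≤D : ∀ {m n} → 1 ≤ m → m ≤ n → d m ≤ D n
d≤D 1≤m m≤n = d≤foldr⊔ (∈-range⁺ 1≤m m≤n)
  where
  d≤foldr⊔ : ∀ {m xs} → m ∈ xs → d m ≤ foldr _⊔_ 0 (map d xs)
  d≤foldr⊔ {xs = x ∷ xs} (here refl) = m≤m⊔n (d x) _
  d≤foldr⊔ {xs = x ∷ xs} (there m∈xs) = m≤n⇒m≤o⊔n (d x) (d≤foldr⊔ m∈xs)

product : ∀ {k} → Vec ℕ k → ℕ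
product []ᵥ       = 1
product (a ∷ᵥ as) = a * product as

module _ (n : ℕ) where

  -- The extra factor c lets the induction peel off the first entry without dividing.
  ∑[b]𝟙[c*product≡m]≤D^k : ∀ k c {m} → 1 ≤ m → m ≤ n →
                           ∑[ b ∈ tuples n k ] 𝟙 (c * product b ≟ m) ≤ D n ^ k
  ∑[b]𝟙[c*product≡m]≤D^k zero    c {m} _ _ = +-monoˡ-≤ 0 (𝟙≤1 (c * 1 ≟ m))
  ∑[b]𝟙[c*product≡m]≤D^k (suc k) c {m} 1≤m m≤n = begin
    ∑ (concatMap (λ a → map (a ∷ᵥ_) T) (range n)) f      ≡⟨ ∑-concatMap f (λ a → map (a ∷ᵥ_) T) (range n) ⟩
    ∑[ a ∈ range n ] ∑ (map (a ∷ᵥ_) T) f                 ≡⟨ ∑-cong (range n) (λ a → ∑-map f (a ∷ᵥ_) T) ⟩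
    ∑[ a ∈ range n ] ∑[ b ∈ T ] f (a ∷ᵥ b)               ≤⟨ ∑-mono (All.universal firstEntry (range n)) ⟩
    ∑[ a ∈ range n ] 𝟙 (a ∣? m) * D n ^ k                ≡⟨ ∑-*ʳ (λ a → 𝟙 (a ∣? m)) (D n ^ k) (range n) ⟩
    (∑[ a ∈ range n ] 𝟙 (a ∣? m)) * D n ^ k              ≡⟨ cong (_* D n ^ k) (∑[a≤n]𝟙[a∣m]≡d 1≤m m≤n) ⟩
    d m * D n ^ k                                        ≤⟨ *-monoˡ-≤ (D n ^ k) (d≤D 1≤m m≤n) ⟩
    D n * D n ^ k                                        ∎
    where
    open ≤-Reasoning
    T = tuples n k
    f : Vec ℕ (suc k) → ℕ
    f b = 𝟙 (c * product b ≟ m)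
    split : ∀ a b → c * (a * product b) ≡ m → a ∣ m × c * a * product b ≡ m
    split a b eq = divides (c * product b) (trans (sym eq) (solve 3 (λ c a p → c :* (a :* p) := c :* p :* a) refl c a (product b)))
                 , trans (*-assoc c a (product b)) eq
      where open +-*-Solver
    firstEntry : ∀ a → ∑[ b ∈ T ] f (a ∷ᵥ b) ≤ 𝟙 (a ∣? m) * D n ^ k
    firstEntry a = begin
      ∑[ b ∈ T ] f (a ∷ᵥ b)                              ≤⟨ ∑-mono (All.universal (λ b → 𝟙-mono-× (split a b) _ (a ∣? m) (c * a * product b ≟ m)) T) ⟩
      ∑[ b ∈ T ] 𝟙 (a ∣? m) * 𝟙 (c * a * product b ≟ m)  ≡⟨ ∑-*ˡ (λ b → 𝟙 (c * a * product b ≟ m)) (𝟙 (a ∣? m)) T ⟩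
      𝟙 (a ∣? m) * (∑[ b ∈ T ] 𝟙 (c * a * product b ≟ m)) ≤⟨ *-monoʳ-≤ (𝟙 (a ∣? m)) (∑[b]𝟙[c*product≡m]≤D^k k (c * a) 1≤m m≤n) ⟩
      𝟙 (a ∣? m) * D n ^ k                               ∎

  1≤product : ∀ k → All (λ a → 1 ≤ product a) (tuples n k)
  1≤product zero    = s≤s z≤n ∷ []
  1≤product (suc k) = Allₚ.concat⁺ (Allₚ.map⁺ {xs = range n} (All.tabulate λ {a} a∈range →
    Allₚ.map⁺ {f = a ∷ᵥ_} (All.map (λ {b} → *-mono-≤ {1} {a} {1} {product b} (proj₁ (∈-range⁻ a∈range))) (1≤product k))))

  ∑[a]𝟙[product*s≤n]≤∑𝟙[m*s≤n]*D^k : ∀ k s → 1 ≤ s →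
    ∑[ a ∈ tuples n k ] 𝟙 (product a * s ≤? n) ≤ (∑[ m ∈ range n ] 𝟙 (m * s ≤? n)) * D n ^ k
  ∑[a]𝟙[product*s≤n]≤∑𝟙[m*s≤n]*D^k k s 1≤s = begin
    ∑[ a ∈ T ] 𝟙 (product a * s ≤? n)                         ≤⟨ ∑𝟙≤∑fibres product (λ m → m * s ≤? n) T (range n) (All.map (λ {a} → inRange {a}) (1≤product k)) ⟩
    ∑[ m ∈ range n ] 𝟙 (m * s ≤? n) * (∑[ a ∈ T ] 𝟙 (product a ≟ m)) ≤⟨ ∑-mono (All.tabulate fibre) ⟩
    ∑[ m ∈ range n ] 𝟙 (m * s ≤? n) * D n ^ k                ≡⟨ ∑-*ʳ (λ m → 𝟙 (m * s ≤? n)) (D n ^ k) (range n) ⟩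
    (∑[ m ∈ range n ] 𝟙 (m * s ≤? n)) * D n ^ k              ∎
    where
    open ≤-Reasoning
    T = tuples n k
    inRange : ∀ {a} → 1 ≤ product a → product a * s ≤ n → product a ∈ range n
    inRange {a} 1≤p p*s≤n = ∈-range⁺ 1≤p (≤-trans (m≤m*n (product a) s {{>-nonZero 1≤s}}) p*s≤n)
    fibre : ∀ {m} → m ∈ range n → 𝟙 (m * s ≤? n) * (∑[ a ∈ T ] 𝟙 (product a ≟ m)) ≤ 𝟙 (m * s ≤? n) * D n ^ k
    fibre {m} m∈range with ∈-range⁻ m∈range
    ... | 1≤m , m≤n = *-monoʳ-≤ (𝟙 (m * s ≤? n)) (begin
      ∑[ a ∈ T ] 𝟙 (product a ≟ m)     ≤⟨ ∑-mono (All.universal (λ a → 𝟙-mono (trans (*-identityˡ (product a))) (product a ≟ m) (1 * product a ≟ m)) T) ⟩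
      ∑[ a ∈ T ] 𝟙 (1 * product a ≟ m) ≤⟨ ∑[b]𝟙[c*product≡m]≤D^k k 1 1≤m m≤n ⟩
      D n ^ k                          ∎)

k≤sum : ∀ {k} (e : Vec ℕ k) → (∀ i → 1 ≤ lookup e i) → k ≤ sum e
k≤sum []ᵥ       _    = z≤n
k≤sum (x ∷ᵥ xs) e≥1 = +-mono-≤ (e≥1 fz) (k≤sum xs (λ i → e≥1 (fs i)))

a*t^x≤a^[1+x] : ∀ {a t} x → (1 ≤ x → t ≤ a) → a * t ^ x ≤ a ^ suc x
a*t^x≤a^[1+x] zero    _   = ≤-refl
a*t^x≤a^[1+x] {a} (suc x) t≤a = *-monoʳ-≤ a (^-monoˡ-≤ (suc x) (t≤a (s≤s z≤n)))

product*t^[sum∸k]≤prodPow : ∀ {k} t (a e : Vec ℕ k) → (∀ i → 1 ≤ lookup e i) →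
  (∀ i → 2 ≤ lookup e i → t ≤ lookup a i) → product a * t ^ (sum e ∸ k) ≤ prodPow a e
product*t^[sum∸k]≤prodPow t []ᵥ []ᵥ _ _ = ≤-refl
product*t^[sum∸k]≤prodPow {suc k} t (y ∷ᵥ as) (zero ∷ᵥ xs) e≥1 _ = contradiction (e≥1 fz) λ ()
product*t^[sum∸k]≤prodPow {suc k} t (y ∷ᵥ as) (suc x ∷ᵥ xs) e≥1 t≤a = begin
  y * product as * t ^ (x + sum xs ∸ k)   ≡⟨ cong (λ z → y * product as * t ^ z) (+-∸-assoc x (k≤sum xs (λ i → e≥1 (fs i)))) ⟩
  y * product as * t ^ (x + r)            ≡⟨ cong (y * product as *_) (^-distribˡ-+-* t x r) ⟩
  y * product as * (t ^ x * t ^ r)        ≡⟨ solve 4 (λ y p u v → y :* p :* (u :* v) := (y :* u) :* (p :* v)) refl y (product as) (t ^ x) (t ^ r) ⟩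
  (y * t ^ x) * (product as * t ^ r)      ≤⟨ *-mono-≤ (a*t^x≤a^[1+x] x (λ 1≤x → t≤a fz (s≤s 1≤x)))
                                                      (product*t^[sum∸k]≤prodPow t as xs (λ i → e≥1 (fs i)) (λ i → t≤a (fs i))) ⟩
  y ^ suc x * prodPow as xs               ∎
  where
  open ≤-Reasoning
  open +-*-Solver
  r = sum xs ∸ k

lemma2p7 : (k : ℕ) (e : Vec ℕ k) (t n : ℕ) →
    ((i : Fin k) → 1 ≤ lookup e i) →
    ((i j : Fin k) → i ≤ᶠ j → lookup e i ≤ lookup e j) →
    1 ≤ t → t ≤ n →
    count n t e * t ^ (sum e ∸ k) ≤ n * D n ^ k
lemma2p7 k e t n e≥1 _ 1≤t _ = begin
  count n t e * s                                        ≡⟨ cong (_* s) (length-filter≡∑𝟙 (good? n t e) T) ⟩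
  (∑[ a ∈ T ] 𝟙 (good? n t e a)) * s                     ≤⟨ *-monoˡ-≤ s (∑-mono (All.universal goodIsSmall T)) ⟩
  (∑[ a ∈ T ] 𝟙 (product a * s ≤? n)) * s                ≤⟨ *-monoˡ-≤ s (∑[a]𝟙[product*s≤n]≤∑𝟙[m*s≤n]*D^k n k s 1≤s) ⟩
  (∑[ m ∈ range n ] 𝟙 (m * s ≤? n)) * D n ^ k * s        ≡⟨ xy∙z≈xz∙y (∑[ m ∈ range n ] 𝟙 (m * s ≤? n)) (D n ^ k) s ⟩
  (∑[ m ∈ range n ] 𝟙 (m * s ≤? n)) * s * D n ^ k        ≤⟨ *-monoˡ-≤ (D n ^ k) (∑[m≤j]𝟙[m*s≤n]*s≤n s n n) ⟩
  n * D n ^ k                                            ∎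
  where
  open ≤-Reasoning
  s = t ^ (sum e ∸ k)
  T = tuples n k
  1≤s : 1 ≤ s
  1≤s = m^n>0 t {{>-nonZero 1≤t}} (sum e ∸ k)
  goodIsSmall : ∀ a → 𝟙 (good? n t e a) ≤ 𝟙 (product a * s ≤? n)
  goodIsSmall a = 𝟙-mono (λ (t≤a , prodPow≤n) → ≤-trans (product*t^[sum∸k]≤prodPow t a e e≥1 t≤a) prodPow≤n)
                         (good? n t e a) (product a * s ≤? n)
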